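{- Let $C$ be a cycle on $r\ge 3$ vertices with distance matrix $\mathbf D$ and $\theta=\lfloor r/2\rfloor\lfloor (r+1)/2\rfloor$. For each $x\in V_C$ let $C_x$ be a cycle (disjoint from $C$ and from the others) on $r_x\ge 3$ vertices, with $\theta_x=\lfloor r_x/2\rfloor\lfloor (r_x+1)/2\rfloor$, and fix a vertex $y_x\in V(C_x)$. Let $G$ be the graph obtained from the disjoint union of $C$ and all $C_x$ by identifying each $x\in V_C$ with $y_x$, and let $\mathbf r$ be the vector indexed by $V_C$ with components $r_x$. Then the degree distance of $G$ is $$ M_G^{\delta}=4\Big(\sum_{x\in V_C}r_x\Big)\Big(\sum_{x\in V_C}\theta_x\Big)+2\Big(\theta\sum_{x\in V_C}r_x+r\sum_{x\in V_C}\theta_x-\sum_{x\in V_C}r_x\theta_x\Big)+2\,\mathbf r^{\top}\mathbf D\,\mathbf r, $$ where $\delta$ is the degree function of $G$.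
   Context: For a connected graph $G$ with vertex set $V$, distance function $\operatorname{dist}$ and a function $\rho:V\to\mathbb{R}$, $M_G^{\rho}=\sum_{u\in V}\sum_{v\in V}\rho(v)\operatorname{dist}(v,u)$; with $\rho=\delta$ the degree function, $M_G^{\delta}$ is the degree distance of $G$. -}

module Defs where

open import Data.Nat using (ℕ; zero; suc; _+_; _*_; _≤_; _≡ᵇ_; _/_)
open import Data.Bool using (Bool; true; false; _∧_; _∨_; if_then_else_; T)
open import Data.Fin using (Fin; toℕ)
open import Data.List using (List; map; allFin; concatMap)
open import Data.Nat.ListAction using (sum)
open import Data.Product using (Σ; _×_; _,_)
open import Data.Integer using (ℤ; +_)

-- Generic finite simple graphs: a vertex type V, an enumeration of V
-- (each vertex listed exactly once), and a Boolean adjacency relation.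

module _ {V : Set} (adj : V → V → Bool) where

  data Walk : V → V → ℕ → Set where
    here : ∀ {u} → Walk u u 0
    step : ∀ {u w v k} → T (adj u w) → Walk w v k → Walk u v (suc k)

  IsDist : V → V → ℕ → Set
  IsDist u v d = Walk u v d × (∀ k → Walk u v k → d ≤ k)

  IsDistFn : (V → V → ℕ) → Set
  IsDistFn dist = ∀ u v → IsDist u v (dist u v)

module _ {V : Set} (verts : List V) (adj : V → V → Bool) where

  degree : V → ℕ
  degree u = sum (map (λ v → if adj u v then 1 else 0) verts)

  degreeDistance : (V → V → ℕ) → ℕ
  degreeDistance dist =
    sum (map (λ u → sum (map (λ v → degree v * dist v u) verts)) verts)

cycStep : ℕ → ℕ → ℕ → Bool
cycStep n a b = (suc a ≡ᵇ b) ∨ ((suc a ≡ᵇ n) ∧ (b ≡ᵇ 0))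

cycAdjℕ : ℕ → ℕ → ℕ → Bool
cycAdjℕ n a b = cycStep n a b ∨ cycStep n b a

cycAdj : (n : ℕ) → Fin n → Fin n → Bool
cycAdj n i j = cycAdjℕ n (toℕ i) (toℕ j)

-- The graph G: C has vertex set Fin r; the cycle C_x has vertex set
-- Fin (rs x); vertex x of C is identified with y x of C_x.  Hence the
-- vertices of G are the pairs (x , i) with i : Fin (rs x), where
-- (x , y x) is the identified vertex x.

GV : (r : ℕ) → (Fin r → ℕ) → Set
GV r rs = Σ (Fin r) (λ x → Fin (rs x))

GVerts : (r : ℕ) (rs : Fin r → ℕ) → List (GV r rs)
GVerts r rs = concatMap (λ x → map (λ i → (x , i)) (allFin (rs x))) (allFin r)

GAdj : (r : ℕ) (rs : Fin r → ℕ) (y : (x : Fin r) → Fin (rs x)) →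
       GV r rs → GV r rs → Bool
GAdj r rs y (x , i) (x' , j) =
     ((toℕ x ≡ᵇ toℕ x') ∧ cycAdjℕ (rs x) (toℕ i) (toℕ j))
  ∨
     (cycAdj r x x' ∧ ((toℕ i ≡ᵇ toℕ (y x)) ∧ (toℕ j ≡ᵇ toℕ (y x'))))

θ : ℕ → ℕ
θ n = (n / 2) * (suc n / 2)

ΣFin : (r : ℕ) → (Fin r → ℕ) → ℕ
ΣFin r f = sum (map f (allFin r))

module Submission where

-- Distances: in any graph, a function
-- that vanishes on the diagonal, drops by at most one along each edge and is
-- realised by walks is the distance (Walks).  Hence the n-cycle has distance
-- min(|a-b|, n-|a-b|) (Cycle), and G has the block distance inside a block
-- and d(i, y_x) + D(x, x') + d(y_x', j) between blocks (CycleOfCycles).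
-- Degrees and transmissions: by rotation invariance every vertex of the
-- n-cycle has degree 2 and transmission θ n; so a vertex of G has degree
-- 2 + 2·[attachment vertex], and the transmission T of (x, i) satisfies
-- T + r_x d(i, y_x) = R d(i, y_x) + E_x + Θ.  Summation: M^δ = 2W + 2H for
-- the total transmission W and the transmission H of the attachment
-- vertices, with W + Q = 2RΘ + P and H = θ R + rΘ.  This is the formula in ℕ
-- with the negative term moved to the left; the theorem transfers it to ℤ.

open import Defs
open import Data.Nat using (ℕ; _≤_; _*_)
open import Data.Bool using (Bool; true; false; _∧_; _∨_; if_then_else_; T)
open import Data.Fin as F using (Fin; toℕ)
open import Data.List using (List; []; _∷_; map; allFin; concatMap)
open import Data.Product using (_×_; _,_; proj₁; proj₂)
open import Data.Sum using (_⊎_; inj₁; inj₂)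
open import Data.Empty using (⊥; ⊥-elim)
open import Function using (_∘_)
open import Relation.Binary.PropositionalEquality

module Booleans where

  open import Data.Nat using (_≡ᵇ_)
  open import Data.Nat.Properties using (≡ᵇ⇒≡; ≡⇒≡ᵇ)
  open import Data.Unit using (tt)

  ind : Bool → ℕ
  ind b = if b then 1 else 0

  ind-true : ∀ {b} → T b → ind b ≡ 1
  ind-true {true} _ = refl

  ind-false : ∀ {b} → (T b → ⊥) → ind b ≡ 0
  ind-false {false} _   = refl
  ind-false {true}  ¬tt = ⊥-elim (¬tt tt)

  ind-∧ : ∀ a b c → ind (a ∧ (b ∧ c)) ≡ ind a * (ind b * ind c)
  ind-∧ true  true  true  = refl
  ind-∧ true  true  false = refl
  ind-∧ true  false c     = refl
  ind-∧ false b     c     = refl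

  T-ext : ∀ {a b} → (T a → T b) → (T b → T a) → a ≡ b
  T-ext {true}  {true}  _ _ = refl
  T-ext {true}  {false} f _ = ⊥-elim (f tt)
  T-ext {false} {true}  _ g = ⊥-elim (g tt)
  T-ext {false} {false} _ _ = refl

  ≡ᵇ-refl : ∀ m → T (m ≡ᵇ m)
  ≡ᵇ-refl m = ≡⇒≡ᵇ m m refl

  ≡ᵇ-true : ∀ m → (m ≡ᵇ m) ≡ true
  ≡ᵇ-true m = T-ext (λ _ → tt) (λ _ → ≡ᵇ-refl m)

  ≡ᵇ-false : ∀ m n → (m ≡ n → ⊥) → (m ≡ᵇ n) ≡ false
  ≡ᵇ-false m n m≢n = T-ext (λ t → m≢n (≡ᵇ⇒≡ m n t)) (λ ())

module FiniteSums where

  open import Data.Nat using (zero; suc; _+_; _<_; _≡ᵇ_)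
  open import Data.Nat.Properties
  open import Data.List using (_++_)
  open import Data.List.Properties using (map-++; map-tabulate)
  open import Data.Nat.ListAction using (sum)
  open import Data.Nat.ListAction.Properties using (sum-++)
  open import Data.Nat.Solver using (module +-*-Solver)
  open +-*-Solver using (solve; _:+_; _:=_; con)
  open Booleans using (ind)

  ΣL : {A : Set} → List A → (A → ℕ) → ℕ
  ΣL xs f = sum (map f xs)

  ΣL-cong : {A : Set} (xs : List A) {f g : A → ℕ} → (∀ a → f a ≡ g a) → ΣL xs f ≡ ΣL xs g
  ΣL-cong []       f≗g = refl
  ΣL-cong (x ∷ xs) f≗g = cong₂ _+_ (f≗g x) (ΣL-cong xs f≗g)

  ΣL-zero : {A : Set} (xs : List A) → ΣL xs (λ _ → 0) ≡ 0
  ΣL-zero []       = refl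
  ΣL-zero (x ∷ xs) = ΣL-zero xs

  ΣL-+ : {A : Set} (xs : List A) (f g : A → ℕ) → ΣL xs (λ a → f a + g a) ≡ ΣL xs f + ΣL xs g
  ΣL-+ []       f g = refl
  ΣL-+ (x ∷ xs) f g rewrite ΣL-+ xs f g =
    solve 4 (λ a b c d → (a :+ b) :+ (c :+ d) := (a :+ c) :+ (b :+ d)) refl (f x) (g x) (ΣL xs f) (ΣL xs g)

  ΣL-*ˡ : {A : Set} (xs : List A) (c : ℕ) (f : A → ℕ) → ΣL xs (λ a → c * f a) ≡ c * ΣL xs f
  ΣL-*ˡ []       c f = sym (*-zeroʳ c)
  ΣL-*ˡ (x ∷ xs) c f rewrite ΣL-*ˡ xs c f = sym (*-distribˡ-+ c (f x) (ΣL xs f))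

  ΣL-*ʳ : {A : Set} (xs : List A) (c : ℕ) (f : A → ℕ) → ΣL xs (λ a → f a * c) ≡ ΣL xs f * c
  ΣL-*ʳ xs c f = trans (ΣL-cong xs (λ a → *-comm (f a) c)) (trans (ΣL-*ˡ xs c f) (*-comm c (ΣL xs f)))

  ΣL-swap : {A B : Set} (xs : List A) (ys : List B) (h : A → B → ℕ) →
            ΣL xs (λ a → ΣL ys (h a)) ≡ ΣL ys (λ b → ΣL xs (λ a → h a b))
  ΣL-swap []       ys h = sym (ΣL-zero ys)
  ΣL-swap (x ∷ xs) ys h rewrite ΣL-swap xs ys h = sym (ΣL-+ ys (h x) (λ b → ΣL xs (λ a → h a b)))

  ΣL-map : {A B : Set} (xs : List A) (g : A → B) (f : B → ℕ) → ΣL (map g xs) f ≡ ΣL xs (f ∘ g)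
  ΣL-map []       g f = refl
  ΣL-map (x ∷ xs) g f = cong (f (g x) +_) (ΣL-map xs g f)

  ΣL-concatMap : {A B : Set} (xs : List A) (h : A → List B) (f : B → ℕ) →
                 ΣL (concatMap h xs) f ≡ ΣL xs (λ a → ΣL (h a) f)
  ΣL-concatMap []       h f = refl
  ΣL-concatMap (x ∷ xs) h f = begin
      sum (map f (h x ++ concatMap h xs))
    ≡⟨ cong sum (map-++ f (h x) (concatMap h xs)) ⟩
      sum (map f (h x) ++ map f (concatMap h xs))
    ≡⟨ sum-++ (map f (h x)) (map f (concatMap h xs)) ⟩
      ΣL (h x) f + ΣL (concatMap h xs) f
    ≡⟨ cong (ΣL (h x) f +_) (ΣL-concatMap xs h f) ⟩
      ΣL (h x) f + ΣL xs (λ a → ΣL (h a) f) ∎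
    where open ≡-Reasoning

  ΣFin-suc : ∀ n (f : Fin (suc n) → ℕ) → ΣFin (suc n) f ≡ f F.zero + ΣFin n (f ∘ F.suc)
  ΣFin-suc n f = cong (λ l → f F.zero + sum l)
    (trans (map-tabulate {n = n} F.suc f) (sym (map-tabulate {n = n} (λ i → i) (f ∘ F.suc))))

  ΣFin-cong : ∀ n {f g : Fin n → ℕ} → (∀ a → f a ≡ g a) → ΣFin n f ≡ ΣFin n g
  ΣFin-cong n = ΣL-cong (allFin n)

  ΣFin-const : ∀ n c → ΣFin n (λ _ → c) ≡ n * c
  ΣFin-const zero    c = refl
  ΣFin-const (suc n) c = trans (ΣFin-suc n (λ _ → c)) (cong (c +_) (ΣFin-const n c))

  ΣFin-indicator : ∀ n (k : Fin n) (f : Fin n → ℕ) → ΣFin n (λ j → ind (toℕ j ≡ᵇ toℕ k) * f j) ≡ f k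
  ΣFin-indicator (suc n) k f = trans (ΣFin-suc n _) (peel k)
    where
    peel : ∀ k → ind (0 ≡ᵇ toℕ k) * f F.zero + ΣFin n (λ j → ind (suc (toℕ j) ≡ᵇ toℕ k) * f (F.suc j))
                 ≡ f k
    peel F.zero    = trans (cong (f F.zero + 0 +_) (ΣL-zero (allFin n))) (trans (+-identityʳ _) (+-identityʳ _))
    peel (F.suc k) = ΣFin-indicator n k (f ∘ F.suc)

  Σ< : ℕ → (ℕ → ℕ) → ℕ
  Σ< zero    g = 0
  Σ< (suc n) g = Σ< n g + g n

  Σ<-front : ∀ n g → Σ< (suc n) g ≡ g 0 + Σ< n (g ∘ suc)
  Σ<-front zero    g = +-comm 0 (g 0)
  Σ<-front (suc n) g rewrite Σ<-front n g = +-assoc (g 0) _ _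

  Σ<-cong : ∀ n {f g : ℕ → ℕ} → (∀ k → k < n → f k ≡ g k) → Σ< n f ≡ Σ< n g
  Σ<-cong zero    f≗g = refl
  Σ<-cong (suc n) f≗g = cong₂ _+_ (Σ<-cong n (λ k k<n → f≗g k (m<n⇒m<1+n k<n))) (f≗g n ≤-refl)

  Σ<-zero : ∀ n f → (∀ k → k < n → f k ≡ 0) → Σ< n f ≡ 0
  Σ<-zero zero    f f≗0 = refl
  Σ<-zero (suc n) f f≗0 = cong₂ _+_ (Σ<-zero n f (λ k k<n → f≗0 k (m<n⇒m<1+n k<n))) (f≗0 n ≤-refl)

  Σ<-suc : ∀ n f → Σ< n (λ c → suc (f c)) ≡ n + Σ< n f
  Σ<-suc zero    f = refl
  Σ<-suc (suc n) f rewrite Σ<-suc n f =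
    solve 3 (λ n s x → (n :+ s) :+ (con 1 :+ x) := (con 1 :+ n) :+ (s :+ x)) refl n (Σ< n f) (f n)

  ΣFin-toℕ : ∀ n (g : ℕ → ℕ) → ΣFin n (g ∘ toℕ) ≡ Σ< n g
  ΣFin-toℕ zero    g = refl
  ΣFin-toℕ (suc n) g rewrite ΣFin-suc n (g ∘ toℕ) | Σ<-front n g = cong (g 0 +_) (ΣFin-toℕ n (g ∘ suc))

module Walks {V : Set} (adj : V → V → Bool) where

  open import Data.Nat using (suc; _+_; s≤s)
  open import Data.Nat.Properties using (≤-reflexive; ≤-trans; ≤-antisym)

  walk-++ : ∀ {a b c k m} → Walk adj a b k → Walk adj b c m → Walk adj a c (k + m)
  walk-++ here       q = q
  walk-++ (step e p) q = step e (walk-++ p q)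

  walk-lower-bound : (F : V → V → ℕ) → (∀ v → F v v ≡ 0) →
                     (∀ u w v → T (adj u w) → F u v ≤ suc (F w v)) →
                     ∀ {u v k} → Walk adj u v k → F u v ≤ k
  walk-lower-bound F F-diag F-step {u} here       = ≤-reflexive (F-diag u)
  walk-lower-bound F F-diag F-step (step {w = w} e p) =
    ≤-trans (F-step _ w _ e) (s≤s (walk-lower-bound F F-diag F-step p))

  dist-characterisation : (dist : V → V → ℕ) → IsDistFn adj dist →
                          (F : V → V → ℕ) → (∀ v → F v v ≡ 0) →
                          (∀ u w v → T (adj u w) → F u v ≤ suc (F w v)) →
                          (∀ u v → Walk adj u v (F u v)) → ∀ u v → dist u v ≡ F u v
  dist-characterisation dist isDist F F-diag F-step F-walk u v =
    ≤-antisym (proj₂ (isDist u v) (F u v) (F-walk u v))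
              (walk-lower-bound F F-diag F-step (proj₁ (isDist u v)))

  dist-edge : (dist : V → V → ℕ) → IsDistFn adj dist → ∀ u w → T (adj u w) → dist u w ≤ 1
  dist-edge dist isDist u w e = proj₂ (isDist u w) 1 (step e here)

map-walk : {U V : Set} {adjU : U → U → Bool} {adjV : V → V → Bool} (f : U → V) →
           (∀ u w → T (adjU u w) → T (adjV (f u) (f w))) →
           ∀ {a b k} → Walk adjU a b k → Walk adjV (f a) (f b) k
map-walk f f-adj here       = here
map-walk f f-adj (step e p) = step (f-adj _ _ e) (map-walk f f-adj p)

module Cycle where

  open import Data.Nat using (zero; suc; _+_; _∸_; _<_; z≤n; s≤s; _≡ᵇ_; _⊓_; ∣_-_∣; _/_)
  open import Data.Fin using (fromℕ<)
  open import Data.Nat.Properties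
  open import Data.Nat.DivMod using (m/n≡1+[m∸n]/n)
  open import Data.Bool.Properties using (T-∨; T-∧)
  open import Data.Fin.Properties using (toℕ-injective; toℕ-fromℕ<; toℕ<n)
  open import Data.Unit using (tt)
  open import Function.Bundles using (Equivalence)
  open Equivalence using (to; from)
  open import Data.Nat.Solver using (module +-*-Solver)
  open +-*-Solver using (solve; _:+_; _:*_; _:=_; con)
  open Booleans
  open FiniteSums

  cycDist : ℕ → ℕ → ℕ → ℕ
  cycDist n a b = ∣ a - b ∣ ⊓ (n ∸ ∣ a - b ∣)

  cycDist-refl : ∀ n a → cycDist n a a ≡ 0
  cycDist-refl n a rewrite ∣n-n∣≡0 a = refl

  cycDist-sym : ∀ n a b → cycDist n a b ≡ cycDist n b a
  cycDist-sym n a b rewrite ∣-∣-comm a b = refl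

  data CycEdge (n a w : ℕ) : Set where
    forward       : suc a ≡ w → CycEdge n a w
    backward      : suc w ≡ a → CycEdge n a w
    wrap-forward  : suc a ≡ n → w ≡ 0 → CycEdge n a w
    wrap-backward : suc w ≡ n → a ≡ 0 → CycEdge n a w

  private
    StepCase : ℕ → ℕ → ℕ → Set
    StepCase n a w = (suc a ≡ w) ⊎ (suc a ≡ n × w ≡ 0)

    step-cases : ∀ n a w → T (cycStep n a w) → StepCase n a w
    step-cases n a w t with to (T-∨ {suc a ≡ᵇ w}) t
    ... | inj₁ e = inj₁ (≡ᵇ⇒≡ (suc a) w e)
    ... | inj₂ e with to (T-∧ {suc a ≡ᵇ n}) e
    ...   | p , q = inj₂ (≡ᵇ⇒≡ (suc a) n p , ≡ᵇ⇒≡ w 0 q)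

    step-intro : ∀ n a w → StepCase n a w → T (cycStep n a w)
    step-intro n a w (inj₁ refl)          = from (T-∨ {suc a ≡ᵇ suc a}) (inj₁ (≡ᵇ-refl (suc a)))
    step-intro n a w (inj₂ (refl , refl)) = from (T-∧ {suc a ≡ᵇ suc a}) (≡ᵇ-refl (suc a) , tt)

  cycEdge : ∀ n a w → T (cycAdjℕ n a w) → CycEdge n a w
  cycEdge n a w t with to (T-∨ {cycStep n a w}) t
  ... | inj₁ s with step-cases n a w s
  ...   | inj₁ p       = forward p
  ...   | inj₂ (p , q) = wrap-forward p q
  cycEdge n a w t | inj₂ s with step-cases n w a s
  ...   | inj₁ p       = backward p
  ...   | inj₂ (p , q) = wrap-backward p q

  cycEdge⁻¹ : ∀ n a w → CycEdge n a w → T (cycAdjℕ n a w)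
  cycEdge⁻¹ n a w (forward p)         = from (T-∨ {cycStep n a w}) (inj₁ (step-intro n a w (inj₁ p)))
  cycEdge⁻¹ n a w (wrap-forward p q)  = from (T-∨ {cycStep n a w}) (inj₁ (step-intro n a w (inj₂ (p , q))))
  cycEdge⁻¹ n a w (backward p)        = from (T-∨ {cycStep n a w}) (inj₂ (step-intro n w a (inj₁ p)))
  cycEdge⁻¹ n a w (wrap-backward p q) = from (T-∨ {cycStep n a w}) (inj₂ (step-intro n w a (inj₂ (p , q))))

  cycAdj-sym : ∀ n a w → T (cycAdjℕ n a w) → T (cycAdjℕ n w a)
  cycAdj-sym n a w t with cycEdge n a w t
  ... | forward p         = cycEdge⁻¹ n w a (backward p)
  ... | backward p        = cycEdge⁻¹ n w a (forward p)
  ... | wrap-forward p q  = cycEdge⁻¹ n w a (wrap-backward p q)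
  ... | wrap-backward p q = cycEdge⁻¹ n w a (wrap-forward p q)

  cycAdj-irrefl : ∀ {n} a → 2 ≤ n → T (cycAdjℕ n a a) → ⊥
  cycAdj-irrefl {n} a 2≤n t with cycEdge n a a t
  ... | forward p            = <⇒≢ (n<1+n a) (sym p)
  ... | backward p           = <⇒≢ (n<1+n a) (sym p)
  ... | wrap-forward p refl  = <⇒≢ 2≤n p
  ... | wrap-backward p refl = <⇒≢ 2≤n p

  ∣1+m-m∣≡1 : ∀ m → ∣ suc m - m ∣ ≡ 1
  ∣1+m-m∣≡1 zero    = refl
  ∣1+m-m∣≡1 (suc m) = ∣1+m-m∣≡1 m

  ∸-suc-bound : ∀ n x y → y ≤ suc x → n ∸ x ≤ suc (n ∸ y)
  ∸-suc-bound n       x       zero    _         = ≤-trans (m∸n≤m n x) (n≤1+n n)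
  ∸-suc-bound zero    x       (suc y) _         = ≤-trans (≤-reflexive (0∸n≡0 x)) z≤n
  ∸-suc-bound (suc n) zero    (suc y) (s≤s y≤0) = s≤s (≤-reflexive (cong (n ∸_) (sym (n≤0⇒n≡0 y≤0))))
  ∸-suc-bound (suc n) (suc x) (suc y) (s≤s y≤x) = ∸-suc-bound n x y y≤x

  -- Both branches of the minimum are 1-Lipschitz in the first argument.
  unit-step : ∀ n a w b → ∣ a - w ∣ ≡ 1 → cycDist n a b ≤ suc (cycDist n w b)
  unit-step n a w b e = ⊓-mono-≤ ∣a-b∣≤ (∸-suc-bound n ∣ a - b ∣ ∣ w - b ∣ ∣w-b∣≤)
    where
    ∣a-b∣≤ : ∣ a - b ∣ ≤ suc ∣ w - b ∣
    ∣a-b∣≤ = ≤-trans (∣-∣-triangle a w b) (≤-reflexive (cong (_+ ∣ w - b ∣) e))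
    ∣w-b∣≤ : ∣ w - b ∣ ≤ suc ∣ a - b ∣
    ∣w-b∣≤ = ≤-trans (∣-∣-triangle w a b) (≤-reflexive (cong (_+ ∣ a - b ∣) (trans (∣-∣-comm w a) e)))

  suc-∸-∸ : ∀ {a b} → b ≤ a → suc a ∸ (a ∸ b) ≡ suc b
  suc-∸-∸ {a} {b} b≤a = trans (+-∸-assoc 1 (m∸n≤m a b)) (cong suc (m∸[m∸n]≡n b≤a))

  near-top : ∀ n a b → suc a ≡ n → b < n → cycDist n a b ≡ (a ∸ b) ⊓ suc b
  near-top n a b refl (s≤s b≤a) rewrite m≤n⇒∣n-m∣≡n∸m b≤a = cong ((a ∸ b) ⊓_) (suc-∸-∸ b≤a)

  cycDist-step : ∀ n a w b → b < n → T (cycAdjℕ n a w) → cycDist n a b ≤ suc (cycDist n w b)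
  cycDist-step n a w b b<n t with cycEdge n a w t
  ... | forward refl = unit-step n a (suc a) b (trans (∣-∣-comm a (suc a)) (∣1+m-m∣≡1 a))
  ... | backward refl = unit-step n (suc w) w b (∣1+m-m∣≡1 w)
  ... | wrap-forward a+1≡n refl rewrite near-top n a b a+1≡n b<n =
        subst (_≤ suc (b ⊓ (n ∸ b))) (⊓-comm (suc b) (a ∸ b)) (⊓-mono-≤ ≤-refl a∸b≤)
    where
    a∸b≤ : a ∸ b ≤ suc (n ∸ b)
    a∸b≤ = ≤-trans (∸-monoˡ-≤ b (n≤1+n a))
                   (≤-trans (≤-reflexive (cong (_∸ b) a+1≡n)) (n≤1+n (n ∸ b)))
  ... | wrap-backward w+1≡n refl rewrite near-top n w b w+1≡n b<n =
        subst (_≤ suc ((w ∸ b) ⊓ suc b)) (⊓-comm (n ∸ b) b)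
          (⊓-mono-≤ n∸b≤ (≤-trans (n≤1+n b) (n≤1+n (suc b))))
    where
    n∸b≤ : n ∸ b ≤ suc (w ∸ b)
    n∸b≤ = ≤-reflexive (trans (cong (_∸ b) (sym w+1≡n)) (+-∸-assoc 1 (≤-pred (subst (b <_) (sym w+1≡n) b<n))))

  -- Walks in the n-cycle on vertex labels (every visited label is < n);
  -- they are built by arithmetic and then transported to Fin n.
  data LWalk (n : ℕ) : ℕ → ℕ → ℕ → Set where
    halt : ∀ {a} → LWalk n a a 0
    hop  : ∀ {a w b k} → w < n → T (cycAdjℕ n a w) → LWalk n w b k → LWalk n a b (suc k)

  lwalk-++ : ∀ {n a b c k m} → LWalk n a b k → LWalk n b c m → LWalk n a c (k + m)
  lwalk-++ halt          q = q
  lwalk-++ (hop w<n e p) q = hop w<n e (lwalk-++ p q)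

  lwalk-reverse : ∀ {n a b k} → a < n → LWalk n a b k → LWalk n b a k
  lwalk-reverse a<n halt = halt
  lwalk-reverse {n} {a} {b} {suc k} a<n (hop {w = w} w<n e p) =
    subst (LWalk n b a) (+-comm k 1) (lwalk-++ (lwalk-reverse w<n p) (hop a<n (cycAdj-sym n a w e) halt))

  walk-up : ∀ n a k → a + k < n → LWalk n a (a + k) k
  walk-up n a zero    _ = subst (λ z → LWalk n a z 0) (sym (+-identityʳ a)) halt
  walk-up n a (suc k) a+k<n = hop (≤-<-trans (s≤s (m≤m+n a k)) a+1+k<n) (cycEdge⁻¹ n a (suc a) (forward refl))
    (subst (λ z → LWalk n (suc a) z k) (sym (+-suc a k)) (walk-up n (suc a) k a+1+k<n))
    where
    a+1+k<n : suc a + k < n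
    a+1+k<n = subst (_< n) (+-suc a k) a+k<n

  walk-down : ∀ n a k → k + a < n → LWalk n (k + a) a k
  walk-down n a zero    _     = halt
  walk-down n a (suc k) 1+k+a<n =
    hop k+a<n (cycEdge⁻¹ n (suc (k + a)) (k + a) (backward refl)) (walk-down n a k k+a<n)
    where
    k+a<n : k + a < n
    k+a<n = ≤-<-trans (n≤1+n (k + a)) 1+k+a<n

  -- From a to a+d in the cycle on a+d+e+1 vertices there is a walk of
  -- length d (going up) and one of length a+1+e (going down through 0).
  lwalk-upward : ∀ a d e → LWalk (suc (a + d + e)) a (a + d) (cycDist (suc (a + d + e)) a (a + d))
  lwalk-upward a d e = subst (LWalk N a (a + d)) (sym cycDist≡) shorter
    where
    N : ℕ
    N = suc (a + d + e)
    N∸d : N ∸ d ≡ suc (a + e)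
    N∸d = trans (cong (_∸ d) (solve 3 (λ a d e → con 1 :+ ((a :+ d) :+ e) := d :+ (con 1 :+ (a :+ e))) refl a d e))
                (m+n∸m≡n d (suc (a + e)))
    cycDist≡ : cycDist N a (a + d) ≡ d ⊓ suc (a + e)
    cycDist≡ rewrite ∣m-m+n∣≡n a d = cong (d ⊓_) N∸d
    a+d<N : a + d < N
    a+d<N = s≤s (m≤m+n (a + d) e)
    a<N : a < N
    a<N = ≤-<-trans (m≤m+n a d) a+d<N
    to-0 : LWalk N a 0 a
    to-0 = subst (λ z → LWalk N z 0 a) (+-identityʳ a) (walk-down N 0 a (subst (_< N) (sym (+-identityʳ a)) a<N))
    from-top : LWalk N (a + d + e) (a + d) e
    from-top = subst (λ z → LWalk N z (a + d) e) (+-comm e (a + d))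
                 (walk-down N (a + d) e (subst (_< N) (+-comm (a + d) e) ≤-refl))
    around : LWalk N a (a + d) (a + suc e)
    around = lwalk-++ to-0 (hop ≤-refl (cycEdge⁻¹ N 0 (a + d + e) (wrap-backward refl refl)) from-top)
    shorter : LWalk N a (a + d) (d ⊓ suc (a + e))
    shorter with ≤-total d (suc (a + e))
    ... | inj₁ d≤ = subst (LWalk N a (a + d)) (sym (m≤n⇒m⊓n≡m d≤)) (walk-up N a d a+d<N)
    ... | inj₂ d≥ = subst (LWalk N a (a + d)) (trans (+-suc a e) (sym (m≥n⇒m⊓n≡n d≥))) around

  lwalk-ordered : ∀ n a b → a ≤ b → b < n → LWalk n a b (cycDist n a b)
  lwalk-ordered (suc m) a b a≤b (s≤s b≤m) = reindex (b ∸ a) (m ∸ b) (sym (m+[n∸m]≡n a≤b)) size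
    where
    size : suc m ≡ suc (a + (b ∸ a) + (m ∸ b))
    size = cong suc (trans (sym (m+[n∸m]≡n b≤m)) (cong (_+ (m ∸ b)) (sym (m+[n∸m]≡n a≤b))))
    reindex : ∀ {n b} d e → b ≡ a + d → n ≡ suc (a + d + e) → LWalk n a b (cycDist n a b)
    reindex d e refl refl = lwalk-upward a d e

  lwalk-cycDist : ∀ n a b → a < n → b < n → LWalk n a b (cycDist n a b)
  lwalk-cycDist n a b a<n b<n with ≤-total a b
  ... | inj₁ a≤b = lwalk-ordered n a b a≤b b<n
  ... | inj₂ b≤a = subst (LWalk n a b) (cycDist-sym n b a) (lwalk-reverse b<n (lwalk-ordered n b a b≤a a<n))

  lwalk→walk : ∀ n {a b k} → LWalk n a b k → (i j : Fin n) → toℕ i ≡ a → toℕ j ≡ b →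
               Walk (cycAdj n) i j k
  lwalk→walk n halt i j i≡a j≡a =
    subst (λ z → Walk (cycAdj n) i z 0) (toℕ-injective (trans i≡a (sym j≡a))) here
  lwalk→walk n (hop w<n e p) i j refl j≡b =
    step (subst (λ v → T (cycAdjℕ n (toℕ i) v)) (sym (toℕ-fromℕ< w<n)) e)
         (lwalk→walk n p (fromℕ< w<n) j (toℕ-fromℕ< w<n) j≡b)

  cycle-walk : ∀ n (i j : Fin n) → Walk (cycAdj n) i j (cycDist n (toℕ i) (toℕ j))
  cycle-walk n i j = lwalk→walk n (lwalk-cycDist n (toℕ i) (toℕ j) (toℕ<n i) (toℕ<n j)) i j refl refl

  cycle-distance : ∀ n (D : Fin n → Fin n → ℕ) → IsDistFn (cycAdj n) D →
                   ∀ i j → D i j ≡ cycDist n (toℕ i) (toℕ j)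
  cycle-distance n D isDist =
    Walks.dist-characterisation (cycAdj n) D isDist (λ i j → cycDist n (toℕ i) (toℕ j))
    (λ v → cycDist-refl n (toℕ v))
    (λ u w v e → cycDist-step n (toℕ u) (toℕ w) (toℕ v) (toℕ<n v) e)
    (cycle-walk n)

  Σ<-rotation : ∀ n (g : ℕ → ℕ → ℕ) →
    (∀ a b → suc a < n → suc b < n → g (suc a) (suc b) ≡ g a b) →
    (∀ a → suc a < n → g (suc a) 0 ≡ g a (n ∸ 1)) →
    ∀ a → a < n → Σ< n (g a) ≡ Σ< n (g 0)
  Σ<-rotation (suc m) g shift wrap zero    _   = refl
  Σ<-rotation (suc m) g shift wrap (suc a) a<n =
    trans rotate (Σ<-rotation (suc m) g shift wrap a (<-trans (n<1+n a) a<n))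
    where
    rotate : Σ< (suc m) (g (suc a)) ≡ Σ< (suc m) (g a)
    rotate = trans (Σ<-front m (g (suc a)))
             (trans (cong₂ _+_ (wrap a a<n) (Σ<-cong m (λ k k<m → shift a k a<n (s≤s k<m))))
                    (+-comm (g a m) (Σ< m (g a))))

  half-suc-suc : ∀ n → suc (suc n) / 2 ≡ suc (n / 2)
  half-suc-suc n = m/n≡1+[m∸n]/n {suc (suc n)} {2} (s≤s (s≤s z≤n))

  halves : ∀ n → n / 2 + suc n / 2 ≡ n
  halves zero          = refl
  halves (suc zero)    = refl
  halves (suc (suc n)) rewrite half-suc-suc n | half-suc-suc (suc n) =
    cong suc (trans (+-suc (n / 2) (suc n / 2)) (cong suc (halves n)))

  θ-suc-suc : ∀ n → θ (suc (suc n)) ≡ θ n + suc n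
  θ-suc-suc n rewrite half-suc-suc n | half-suc-suc (suc n) =
    trans (solve 2 (λ A B → (con 1 :+ A) :* (con 1 :+ B) := A :* B :+ (con 1 :+ (A :+ B))) refl (n / 2) (suc n / 2))
          (cong (λ z → θ n + suc z) (halves n))

  Σ<-min : ∀ n → Σ< n (λ b → b ⊓ (n ∸ b)) ≡ θ n
  Σ<-min zero          = refl
  Σ<-min (suc zero)    = refl
  Σ<-min (suc (suc n)) = begin
      Σ< (suc n) h + h (suc n)
    ≡⟨ cong₂ _+_ (Σ<-front n h) last ⟩
      Σ< n (h ∘ suc) + 1
    ≡⟨ cong (_+ 1) (Σ<-cong n middle) ⟩
      Σ< n (λ c → suc (c ⊓ (n ∸ c))) + 1
    ≡⟨ cong (_+ 1) (Σ<-suc n (λ c → c ⊓ (n ∸ c))) ⟩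
      n + Σ< n (λ c → c ⊓ (n ∸ c)) + 1
    ≡⟨ cong (λ z → n + z + 1) (Σ<-min n) ⟩
      n + θ n + 1
    ≡⟨ solve 2 (λ n t → n :+ t :+ con 1 := t :+ (con 1 :+ n)) refl n (θ n) ⟩
      θ n + suc n
    ≡⟨ sym (θ-suc-suc n) ⟩
      θ (suc (suc n)) ∎
    where
    open ≡-Reasoning
    h : ℕ → ℕ
    h b = b ⊓ (suc (suc n) ∸ b)
    last : h (suc n) ≡ 1
    last = trans (cong (suc n ⊓_) (trans (+-∸-assoc 1 (≤-refl {n})) (cong suc (n∸n≡0 n))))
                 (cong suc (⊓-zeroʳ n))
    middle : ∀ c → c < n → h (suc c) ≡ suc (c ⊓ (n ∸ c))
    middle c c<n = cong (suc c ⊓_) (+-∸-assoc 1 (<⇒≤ c<n))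

  cycle-transmission : ∀ n a → a < n → Σ< n (cycDist n a) ≡ θ n
  cycle-transmission (suc m) a a<n =
    trans (Σ<-rotation (suc m) (cycDist (suc m)) (λ _ _ _ _ → refl) wrap a a<n) (Σ<-min (suc m))
    where
    wrap : ∀ a → suc a < suc m → cycDist (suc m) (suc a) 0 ≡ cycDist (suc m) a m
    wrap a (s≤s a<m) rewrite m≤n⇒∣m-n∣≡n∸m (<⇒≤ a<m) =
      trans (⊓-comm (suc a) _) (cong ((m ∸ a) ⊓_) (sym (suc-∸-∸ (<⇒≤ a<m))))

  -- The neighbours of 0 are 1 and n-1.
  cycle-degree-of-0 : ∀ m → Σ< (3 + m) (λ b → ind (cycAdjℕ (3 + m) 0 b)) ≡ 2
  cycle-degree-of-0 m = begin
      Σ< (suc (suc m)) G + G (suc (suc m))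
    ≡⟨ cong₂ _+_ (trans (Σ<-front (suc m) G) (cong (G 0 +_) (Σ<-front m (G ∘ suc))))
                 (ind-true (cycEdge⁻¹ N 0 (suc (suc m)) (wrap-backward refl refl))) ⟩
      G 0 + (G 1 + Σ< m (G ∘ suc ∘ suc)) + 1
    ≡⟨ cong (λ z → G 0 + (G 1 + z) + 1) (Σ<-zero m (G ∘ suc ∘ suc) non-neighbours) ⟩
      G 0 + (G 1 + 0) + 1
    ≡⟨ cong₂ (λ u v → u + (v + 0) + 1) (ind-false (cycAdj-irrefl {N} 0 (s≤s (s≤s z≤n))))
                                      (ind-true (cycEdge⁻¹ N 0 1 (forward refl))) ⟩
      2 ∎
    where
    open ≡-Reasoning
    N : ℕ
    N = suc (suc (suc m))
    G : ℕ → ℕ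
    G b = ind (cycAdjℕ N 0 b)
    non-neighbours : ∀ c → c < m → G (suc (suc c)) ≡ 0
    non-neighbours c c<m = ind-false not-adjacent
      where
      not-adjacent : T (cycAdjℕ N 0 (suc (suc c))) → ⊥
      not-adjacent t with cycEdge N 0 (suc (suc c)) t
      ... | forward ()
      ... | backward ()
      ... | wrap-forward () _
      ... | wrap-backward p _ = <⇒≢ c<m (suc-injective (suc-injective (suc-injective p)))

  cycle-degree : ∀ n a → 3 ≤ n → a < n → Σ< n (λ b → ind (cycAdjℕ n a b)) ≡ 2
  cycle-degree (suc zero)       _ (s≤s ())       _
  cycle-degree (suc (suc zero)) _ (s≤s (s≤s ())) _
  cycle-degree n@(suc (suc (suc m))) a _ a<n = trans (Σ<-rotation n g shift wrap a a<n) (cycle-degree-of-0 m)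
    where
    g : ℕ → ℕ → ℕ
    g a b = ind (cycAdjℕ n a b)
    shift : ∀ a b → suc a < n → suc b < n → g (suc a) (suc b) ≡ g a b
    shift a b 1+a<n 1+b<n = cong ind (T-ext down up)
      where
      down : T (cycAdjℕ n (suc a) (suc b)) → T (cycAdjℕ n a b)
      down t with cycEdge n (suc a) (suc b) t
      ... | forward p        = cycEdge⁻¹ n a b (forward (suc-injective p))
      ... | backward p       = cycEdge⁻¹ n a b (backward (suc-injective p))
      ... | wrap-forward _ ()
      ... | wrap-backward _ ()
      up : T (cycAdjℕ n a b) → T (cycAdjℕ n (suc a) (suc b))
      up t with cycEdge n a b t
      ... | forward p         = cycEdge⁻¹ n (suc a) (suc b) (forward (cong suc p))
      ... | backward p        = cycEdge⁻¹ n (suc a) (suc b) (backward (cong suc p))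
      ... | wrap-forward p _  = ⊥-elim (<⇒≢ 1+a<n p)
      ... | wrap-backward p _ = ⊥-elim (<⇒≢ 1+b<n p)
    wrap : ∀ a → suc a < n → g (suc a) 0 ≡ g a (n ∸ 1)
    wrap a 1+a<n = cong ind (T-ext down up)
      where
      down : T (cycAdjℕ n (suc a) 0) → T (cycAdjℕ n a (n ∸ 1))
      down t with cycEdge n (suc a) 0 t
      ... | forward ()
      ... | backward refl     = cycEdge⁻¹ n 0 (n ∸ 1) (wrap-backward refl refl)
      ... | wrap-forward p _  = cycEdge⁻¹ n a (n ∸ 1) (forward (suc-injective p))
      ... | wrap-backward _ ()
      up : T (cycAdjℕ n a (n ∸ 1)) → T (cycAdjℕ n (suc a) 0)
      up t with cycEdge n a (n ∸ 1) t
      ... | forward p            = cycEdge⁻¹ n (suc a) 0 (wrap-forward (cong suc p) refl)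
      ... | backward p           = ⊥-elim (<⇒≢ (<-trans (n<1+n a) 1+a<n) (sym p))
      ... | wrap-forward p _     = ⊥-elim (<⇒≢ 1+a<n p)
      ... | wrap-backward _ refl = cycEdge⁻¹ n 1 0 (backward refl)

module CycleOfCycles (r : ℕ) (3≤r : 3 ≤ r) (rs : Fin r → ℕ) (3≤rs : ∀ x → 3 ≤ rs x)
                     (y : (x : Fin r) → Fin (rs x))
                     (D : Fin r → Fin r → ℕ) (D-dist : IsDistFn (cycAdj r) D) where

  open import Data.Nat using (suc; _+_; _<_; _≡ᵇ_)
  open import Data.Nat.Properties
  open import Data.Bool.Properties using (T-∨; T-∧)
  open import Data.Fin.Properties using (toℕ-injective; toℕ<n)
  open import Relation.Nullary using (yes; no)
  open import Function.Bundles using (Equivalence)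
  open Equivalence using (to; from)
  open import Data.Nat.Solver using (module +-*-Solver)
  open +-*-Solver using (solve; _:+_; _:*_; _:=_; con)
  open Booleans
  open FiniteSums
  open Cycle
  open Walks (GAdj r rs y)

  V : Set
  V = GV r rs

  adjG : V → V → Bool
  adjG = GAdj r rs y

  dC : (x : Fin r) → Fin (rs x) → Fin (rs x) → ℕ
  dC x i j = cycDist (rs x) (toℕ i) (toℕ j)

  -- The distance of G: inside one block it is the block distance,
  -- otherwise the path runs through the two attachment vertices and C.
  dG : V → V → ℕ
  dG (x , i) (x' , j) with x F.≟ x'
  ... | yes refl = dC x i j
  ... | no  _    = dC x i (y x) + D x x' + dC x' (y x') j

  data GEdge : V → V → Set where
    inner : ∀ x i j → T (cycAdjℕ (rs x) (toℕ i) (toℕ j)) → GEdge (x , i) (x , j)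
    outer : ∀ x x' → T (cycAdj r x x') → GEdge (x , y x) (x' , y x')

  gEdge : ∀ u w → T (adjG u w) → GEdge u w
  gEdge (x , i) (x' , j) t with to (T-∨ {(toℕ x ≡ᵇ toℕ x') ∧ cycAdjℕ (rs x) (toℕ i) (toℕ j)}) t
  ... | inj₁ e with to (T-∧ {toℕ x ≡ᵇ toℕ x'}) e
  ...   | x≡x' , c with toℕ-injective {i = x} {j = x'} (≡ᵇ⇒≡ _ _ x≡x')
  ...     | refl = inner x i j c
  gEdge (x , i) (x' , j) t | inj₂ e with to (T-∧ {cycAdj r x x'}) e
  ...   | c , e' with to (T-∧ {toℕ i ≡ᵇ toℕ (y x)}) e'
  ...     | i≡y , j≡y with toℕ-injective {i = i} {j = y x} (≡ᵇ⇒≡ _ _ i≡y)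
                           | toℕ-injective {i = j} {j = y x'} (≡ᵇ⇒≡ _ _ j≡y)
  ...       | refl | refl = outer x x' c

  inner-adj : ∀ x i j → T (cycAdjℕ (rs x) (toℕ i) (toℕ j)) → T (adjG (x , i) (x , j))
  inner-adj x i j c = from T-∨ (inj₁ (from T-∧ (≡ᵇ-refl (toℕ x) , c)))

  outer-adj : ∀ x x' → T (cycAdj r x x') → T (adjG (x , y x) (x' , y x'))
  outer-adj x x' c = from (T-∨ {(toℕ x ≡ᵇ toℕ x') ∧ _})
                          (inj₂ (from T-∧ (c , from T-∧ (≡ᵇ-refl (toℕ (y x)) , ≡ᵇ-refl (toℕ (y x'))))))

  C-irrefl : ∀ x → T (cycAdj r x x) → ⊥
  C-irrefl x = cycAdj-irrefl (toℕ x) (≤-trans (n≤1+n 2) 3≤r)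

  D≡cycDist : ∀ x x' → D x x' ≡ cycDist r (toℕ x) (toℕ x')
  D≡cycDist = cycle-distance r D D-dist

  D-refl : ∀ x → D x x ≡ 0
  D-refl x = trans (D≡cycDist x x) (cycDist-refl r (toℕ x))

  D-step : ∀ x x' z → T (cycAdj r x x') → D x z ≤ suc (D x' z)
  D-step x x' z c rewrite D≡cycDist x z | D≡cycDist x' z = cycDist-step r (toℕ x) (toℕ x') (toℕ z) (toℕ<n z) c

  D-edge : ∀ x x' → T (cycAdj r x x') → D x x' ≤ 1
  D-edge = Walks.dist-edge (cycAdj r) D D-dist

  dG-refl : ∀ v → dG v v ≡ 0
  dG-refl (x , i) with x F.≟ x
  ... | yes refl = cycDist-refl (rs x) (toℕ i)
  ... | no  x≢x  = ⊥-elim (x≢x refl)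

  dG-step : ∀ u w v → T (adjG u w) → dG u v ≤ suc (dG w v)
  dG-step u w v e = by-edge (gEdge u w e) v
    where
    by-edge : ∀ {u w} → GEdge u w → ∀ v → dG u v ≤ suc (dG w v)
    by-edge (inner x i j c) (z , k) with x F.≟ z
    ... | yes refl = cycDist-step (rs x) (toℕ i) (toℕ j) (toℕ k) (toℕ<n k) c
    ... | no  _    = +-monoˡ-≤ (dC z (y z) k) (+-monoˡ-≤ (D x z)
                       (cycDist-step (rs x) (toℕ i) (toℕ j) (toℕ (y x)) (toℕ<n (y x)) c))
    by-edge (outer x x' c) (z , k) with x F.≟ z | x' F.≟ z
    ... | yes refl | yes refl = ⊥-elim (C-irrefl x c)
    ... | yes refl | no  _ rewrite cycDist-refl (rs x') (toℕ (y x')) =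
          ≤-trans (m≤n+m (dC x (y x) k) (D x' x)) (n≤1+n _)
    ... | no  _    | yes refl rewrite cycDist-refl (rs x) (toℕ (y x)) =
          +-monoˡ-≤ (dC x' (y x') k) (D-edge x x' c)
    ... | no  _    | no  _ rewrite cycDist-refl (rs x) (toℕ (y x)) | cycDist-refl (rs x') (toℕ (y x')) =
          +-monoˡ-≤ (dC z (y z) k) (D-step x x' z c)

  inner-walk : ∀ x i j → Walk adjG (x , i) (x , j) (dC x i j)
  inner-walk x i j = map-walk (x ,_) (inner-adj x) (cycle-walk (rs x) i j)

  outer-walk : ∀ x x' → Walk adjG (x , y x) (x' , y x') (D x x')
  outer-walk x x' = map-walk (λ z → (z , y z)) outer-adj (proj₁ (D-dist x x'))

  dG-walk : ∀ u v → Walk adjG u v (dG u v)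
  dG-walk (x , i) (x' , j) with x F.≟ x'
  ... | yes refl = inner-walk x i j
  ... | no  _    = walk-++ (walk-++ (inner-walk x i (y x)) (outer-walk x x')) (inner-walk x' (y x') j)

  G-distance : (dist : V → V → ℕ) → IsDistFn adjG dist → ∀ u v → dist u v ≡ dG u v
  G-distance dist isDist = dist-characterisation dist isDist dG dG-refl dG-step dG-walk

  ΣV : (V → ℕ) → ℕ
  ΣV f = ΣFin r (λ x → ΣFin (rs x) (λ i → f (x , i)))

  ΣV-verts : ∀ f → ΣL (GVerts r rs) f ≡ ΣV f
  ΣV-verts f = trans (ΣL-concatMap (allFin r) (λ x → map (x ,_) (allFin (rs x))) f)
                     (ΣL-cong (allFin r) (λ x → ΣL-map (allFin (rs x)) (x ,_) f))

  attach : (x : Fin r) → Fin (rs x) → ℕ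
  attach x i = ind (toℕ i ≡ᵇ toℕ (y x))

  neighbours-in : ∀ x i x' → ΣFin (rs x') (λ j → ind (adjG (x , i) (x' , j)))
                              ≡ ind (toℕ x' ≡ᵇ toℕ x) * 2 + attach x i * ind (cycAdj r x x')
  neighbours-in x i x' with x' F.≟ x
  ... | yes refl = begin
      ΣFin (rs x) (λ j → ind (adjG (x , i) (x , j)))
    ≡⟨ ΣFin-cong (rs x) (λ j → cong ind (T-ext (only-inner j) (inner-adj x i j))) ⟩
      ΣFin (rs x) (λ j → ind (cycAdjℕ (rs x) (toℕ i) (toℕ j)))
    ≡⟨ ΣFin-toℕ (rs x) (λ b → ind (cycAdjℕ (rs x) (toℕ i) b)) ⟩
      Σ< (rs x) (λ b → ind (cycAdjℕ (rs x) (toℕ i) b))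
    ≡⟨ cycle-degree (rs x) (toℕ i) (3≤rs x) (toℕ<n i) ⟩
      2
    ≡⟨ cong (2 +_) (*-zeroʳ (attach x i)) ⟨
      2 + attach x i * 0
    ≡⟨ cong₂ (λ u v → ind u * 2 + attach x i * v) (≡ᵇ-true (toℕ x)) (ind-false (C-irrefl x)) ⟨
      ind (toℕ x ≡ᵇ toℕ x) * 2 + attach x i * ind (cycAdj r x x) ∎
    where
    open ≡-Reasoning
    only-inner : ∀ j → T (adjG (x , i) (x , j)) → T (cycAdjℕ (rs x) (toℕ i) (toℕ j))
    only-inner j t with gEdge (x , i) (x , j) t
    ... | inner .x .i .j c = c
    ... | outer .x .x c    = ⊥-elim (C-irrefl x c)
  ... | no x'≢x rewrite ≡ᵇ-false (toℕ x) (toℕ x') (λ e → x'≢x (sym (toℕ-injective e)))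
                      | ≡ᵇ-false (toℕ x') (toℕ x) (λ e → x'≢x (toℕ-injective e)) = begin
      ΣFin (rs x') (λ j → ind (cycAdj r x x' ∧ ((toℕ i ≡ᵇ toℕ (y x)) ∧ (toℕ j ≡ᵇ toℕ (y x')))))
    ≡⟨ ΣFin-cong (rs x') (λ j → ind-∧ (cycAdj r x x') (toℕ i ≡ᵇ toℕ (y x)) (toℕ j ≡ᵇ toℕ (y x')))
    ⟩
      ΣFin (rs x') (λ j → A * (e * ind (toℕ j ≡ᵇ toℕ (y x'))))
    ≡⟨ ΣL-*ˡ (allFin (rs x')) A (λ j → e * ind (toℕ j ≡ᵇ toℕ (y x'))) ⟩
      A * ΣFin (rs x') (λ j → e * ind (toℕ j ≡ᵇ toℕ (y x')))
    ≡⟨ cong (A *_) (ΣL-*ˡ (allFin (rs x')) e (λ j → ind (toℕ j ≡ᵇ toℕ (y x')))) ⟩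
      A * (e * ΣFin (rs x') (λ j → ind (toℕ j ≡ᵇ toℕ (y x'))))
    ≡⟨ cong (λ z → A * (e * z)) (trans (ΣFin-cong (rs x') (λ j → sym (*-identityʳ _)))
                                       (ΣFin-indicator (rs x') (y x') (λ _ → 1))) ⟩
      A * (e * 1)
    ≡⟨ solve 2 (λ A e → A :* (e :* con 1) := e :* A) refl A e ⟩
      e * A ∎
    where
    open ≡-Reasoning
    A e : ℕ
    A = ind (cycAdj r x x')
    e = attach x i

  degree-G : ∀ x i → degree (GVerts r rs) adjG (x , i) ≡ 2 + attach x i * 2
  degree-G x i = begin
      ΣL (GVerts r rs) (λ v → ind (adjG (x , i) v))
    ≡⟨ ΣV-verts (λ v → ind (adjG (x , i) v)) ⟩
      ΣFin r (λ x' → ΣFin (rs x') (λ j → ind (adjG (x , i) (x' , j))))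
    ≡⟨ ΣFin-cong r (neighbours-in x i) ⟩
      ΣFin r (λ x' → ind (toℕ x' ≡ᵇ toℕ x) * 2 + attach x i * ind (cycAdj r x x'))
    ≡⟨ ΣL-+ (allFin r) _ _ ⟩
      ΣFin r (λ x' → ind (toℕ x' ≡ᵇ toℕ x) * 2) + ΣFin r (λ x' → attach x i * ind (cycAdj r x x'))
    ≡⟨ cong₂ _+_ (ΣFin-indicator r x (λ _ → 2)) (ΣL-*ˡ (allFin r) (attach x i) _) ⟩
      2 + attach x i * ΣFin r (λ x' → ind (cycAdj r x x'))
    ≡⟨ cong (λ z → 2 + attach x i * z) (trans (ΣFin-toℕ r (λ b → ind (cycAdjℕ r (toℕ x) b)))
                                              (cycle-degree r (toℕ x) 3≤r (toℕ<n x))) ⟩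
      2 + attach x i * 2 ∎
    where open ≡-Reasoning

  R Θ Q P : ℕ
  R = ΣFin r rs
  Θ = ΣFin r (λ x → θ (rs x))
  Q = ΣFin r (λ x → rs x * θ (rs x))
  P = ΣFin r (λ x → ΣFin r (λ x' → rs x * D x x' * rs x'))

  E : Fin r → ℕ
  E x = ΣFin r (λ x' → rs x' * D x x')

  toHub : (x : Fin r) → Fin (rs x) → ℕ
  toHub x i = dC x i (y x)

  transmission : V → ℕ
  transmission v = ΣV (dG v)

  dC-row : ∀ x k → ΣFin (rs x) (dC x k) ≡ θ (rs x)
  dC-row x k = trans (ΣFin-toℕ (rs x) (cycDist (rs x) (toℕ k))) (cycle-transmission (rs x) (toℕ k) (toℕ<n k))

  toHub-sum : ∀ x → ΣFin (rs x) (toHub x) ≡ θ (rs x)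
  toHub-sum x = trans (ΣFin-cong (rs x) (λ i → cycDist-sym (rs x) (toℕ i) (toℕ (y x)))) (dC-row x (y x))

  toHub-hub : ∀ x → toHub x (y x) ≡ 0
  toHub-hub x = cycDist-refl (rs x) (toℕ (y x))

  -- The contribution of block C_x' to the transmission of (x , i); the
  -- correction term on the left is nonzero only for the own block x' = x.
  block-contribution : ∀ x i x' →
    ΣFin (rs x') (λ j → dG (x , i) (x' , j)) + ind (toℕ x' ≡ᵇ toℕ x) * (rs x * toHub x i)
    ≡ toHub x i * rs x' + rs x' * D x x' + θ (rs x')
  block-contribution x i x' with x F.≟ x'
  ... | yes refl rewrite ≡ᵇ-true (toℕ x) | D-refl x | dC-row x i =
        solve 3 (λ t s e → t :+ con 1 :* (s :* e) := e :* s :+ s :* con 0 :+ t) refl (θ (rs x)) (rs x) (toHub x i)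
  ... | no  x≢x' rewrite ≡ᵇ-false (toℕ x') (toℕ x) (λ e → x≢x' (sym (toℕ-injective e)))
                       | ΣL-+ (allFin (rs x')) (λ _ → toHub x i + D x x') (dC x' (y x'))
                       | ΣFin-const (rs x') (toHub x i + D x x') | dC-row x' (y x') =
        solve 4 (λ s e d t → s :* (e :+ d) :+ t :+ con 0 := e :* s :+ s :* d :+ t)
                refl (rs x') (toHub x i) (D x x') (θ (rs x'))

  transmission-formula : ∀ x i → transmission (x , i) + rs x * toHub x i ≡ R * toHub x i + E x + Θ
  transmission-formula x i = begin
      transmission (x , i) + rs x * h
    ≡⟨ cong (transmission (x , i) +_) (ΣFin-indicator r x (λ _ → rs x * h)) ⟨
      transmission (x , i) + ΣFin r (λ x' → ind (toℕ x' ≡ᵇ toℕ x) * (rs x * h))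
    ≡⟨ ΣL-+ (allFin r) _ _ ⟨
      ΣFin r (λ x' → ΣFin (rs x') (λ j → dG (x , i) (x' , j)) + ind (toℕ x' ≡ᵇ toℕ x) * (rs x * h))
    ≡⟨ ΣFin-cong r (block-contribution x i) ⟩
      ΣFin r (λ x' → h * rs x' + rs x' * D x x' + θ (rs x'))
    ≡⟨ ΣL-+ (allFin r) _ _ ⟩
      ΣFin r (λ x' → h * rs x' + rs x' * D x x') + Θ
    ≡⟨ cong (_+ Θ) (ΣL-+ (allFin r) _ _) ⟩
      ΣFin r (λ x' → h * rs x') + E x + Θ
    ≡⟨ cong (λ z → z + E x + Θ) (trans (ΣL-*ˡ (allFin r) h rs) (*-comm h R)) ⟩
      R * h + E x + Θ ∎
    where
    open ≡-Reasoning
    h : ℕ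
    h = toHub x i

  hub-transmission : ∀ x → transmission (x , y x) ≡ E x + Θ
  hub-transmission x = begin
      transmission (x , y x)
    ≡⟨ +-identityʳ _ ⟨
      transmission (x , y x) + 0
    ≡⟨ cong (λ z → transmission (x , y x) + z) (trans (cong (rs x *_) (toHub-hub x)) (*-zeroʳ (rs x))) ⟨
      transmission (x , y x) + rs x * toHub x (y x)
    ≡⟨ transmission-formula x (y x) ⟩
      R * toHub x (y x) + E x + Θ
    ≡⟨ cong (λ z → z + E x + Θ) (trans (cong (R *_) (toHub-hub x)) (*-zeroʳ R)) ⟩
      E x + Θ ∎
    where open ≡-Reasoning

  block-transmission : ∀ x → ΣFin (rs x) (λ i → transmission (x , i)) + rs x * θ (rs x)
                             ≡ R * θ (rs x) + rs x * E x + rs x * Θ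
  block-transmission x = begin
      ΣFin (rs x) (λ i → transmission (x , i)) + rs x * θ (rs x)
    ≡⟨ cong (λ z → ΣFin (rs x) (λ i → transmission (x , i)) + z)
            (trans (ΣL-*ˡ (allFin (rs x)) (rs x) (toHub x)) (cong (rs x *_) (toHub-sum x))) ⟨
      ΣFin (rs x) (λ i → transmission (x , i)) + ΣFin (rs x) (λ i → rs x * toHub x i)
    ≡⟨ ΣL-+ (allFin (rs x)) _ _ ⟨
      ΣFin (rs x) (λ i → transmission (x , i) + rs x * toHub x i)
    ≡⟨ ΣFin-cong (rs x) (transmission-formula x) ⟩
      ΣFin (rs x) (λ i → R * toHub x i + E x + Θ)
    ≡⟨ trans (ΣL-+ (allFin (rs x)) _ _) (cong₂ _+_ (ΣL-+ (allFin (rs x)) _ _) (ΣFin-const (rs x) Θ)) ⟩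
      ΣFin (rs x) (λ i → R * toHub x i) + ΣFin (rs x) (λ _ → E x) + rs x * Θ
    ≡⟨ cong₂ (λ u v → u + v + rs x * Θ) (trans (ΣL-*ˡ (allFin (rs x)) R (toHub x)) (cong (R *_) (toHub-sum x)))
                                       (ΣFin-const (rs x) (E x)) ⟩
      R * θ (rs x) + rs x * E x + rs x * Θ ∎
    where open ≡-Reasoning

  W H : ℕ
  W = ΣV transmission
  H = ΣFin r (λ x → transmission (x , y x))

  -- Since deg = 2 + 2·[attachment vertex], M^δ = 2W + 2H.
  degreeDistance-split : (dist : V → V → ℕ) → IsDistFn adjG dist →
                         degreeDistance (GVerts r rs) adjG dist ≡ 2 * W + 2 * H
  degreeDistance-split dist isDist = begin
      ΣL verts (λ u → ΣL verts (λ v → deg v * dist v u))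
    ≡⟨ ΣL-swap verts verts (λ u v → deg v * dist v u) ⟩
      ΣL verts (λ v → ΣL verts (λ u → deg v * dist v u))
    ≡⟨ ΣL-cong verts (λ v → trans (ΣL-*ˡ verts (deg v) (dist v)) (cong (deg v *_) (row v))) ⟩
      ΣL verts (λ v → deg v * transmission v)
    ≡⟨ ΣV-verts (λ v → deg v * transmission v) ⟩
      ΣFin r (λ x → ΣFin (rs x) (λ i → deg (x , i) * transmission (x , i)))
    ≡⟨ ΣFin-cong r block ⟩
      ΣFin r (λ x → 2 * ΣFin (rs x) (λ i → transmission (x , i)) + 2 * transmission (x , y x))
    ≡⟨ trans (ΣL-+ (allFin r) _ _) (cong₂ _+_ (ΣL-*ˡ (allFin r) 2 _) (ΣL-*ˡ (allFin r) 2 _)) ⟩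
      2 * W + 2 * H ∎
    where
    open ≡-Reasoning
    verts : List V
    verts = GVerts r rs
    row : ∀ v → ΣL verts (dist v) ≡ transmission v
    row v = trans (ΣL-cong verts (G-distance dist isDist v)) (ΣV-verts (dG v))
    deg : V → ℕ
    deg = degree verts adjG
    block : ∀ x → ΣFin (rs x) (λ i → deg (x , i) * transmission (x , i))
                  ≡ 2 * ΣFin (rs x) (λ i → transmission (x , i)) + 2 * transmission (x , y x)
    block x = begin
        ΣFin (rs x) (λ i → deg (x , i) * t i)
      ≡⟨ ΣFin-cong (rs x) (λ i → trans (cong (_* t i) (degree-G x i))
           (solve 2 (λ a t → (con 2 :+ a :* con 2) :* t := con 2 :* t :+ a :* (con 2 :* t)) refl (attach x i) (t i))) ⟩
        ΣFin (rs x) (λ i → 2 * t i + attach x i * (2 * t i))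
      ≡⟨ ΣL-+ (allFin (rs x)) _ _ ⟩
        ΣFin (rs x) (λ i → 2 * t i) + ΣFin (rs x) (λ i → attach x i * (2 * t i))
      ≡⟨ cong₂ _+_ (ΣL-*ˡ (allFin (rs x)) 2 t) (ΣFin-indicator (rs x) (y x) (λ i → 2 * t i)) ⟩
        2 * ΣFin (rs x) t + 2 * t (y x) ∎
      where
      t : Fin (rs x) → ℕ
      t i = transmission (x , i)

  ΣrE : ΣFin r (λ x → rs x * E x) ≡ P
  ΣrE = ΣFin-cong r (λ x → trans (sym (ΣL-*ˡ (allFin r) (rs x) (λ x' → rs x' * D x x')))
          (ΣFin-cong r (λ x' → solve 3 (λ a b d → a :* (b :* d) := a :* d :* b) refl (rs x) (rs x') (D x x'))))

  -- Σ_x E x = θ r · R, since every column sum of D is θ r.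
  ΣE : ΣFin r E ≡ θ r * R
  ΣE = begin
      ΣFin r (λ x → ΣFin r (λ x' → rs x' * D x x'))
    ≡⟨ ΣL-swap (allFin r) (allFin r) (λ x x' → rs x' * D x x') ⟩
      ΣFin r (λ x' → ΣFin r (λ x → rs x' * D x x'))
    ≡⟨ ΣFin-cong r (λ x' → trans (ΣL-*ˡ (allFin r) (rs x') (λ x → D x x'))
                                 (trans (cong (rs x' *_) (column x')) (*-comm (rs x') (θ r)))) ⟩
      ΣFin r (λ x' → θ r * rs x')
    ≡⟨ ΣL-*ˡ (allFin r) (θ r) rs ⟩
      θ r * R ∎
    where
    open ≡-Reasoning
    column : ∀ x' → ΣFin r (λ x → D x x') ≡ θ r
    column x' = trans (ΣFin-cong r (λ x → trans (D≡cycDist x x') (cycDist-sym r (toℕ x) (toℕ x'))))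
                      (trans (ΣFin-toℕ r (cycDist r (toℕ x'))) (cycle-transmission r (toℕ x') (toℕ<n x')))

  total-transmission : W + Q ≡ 2 * (R * Θ) + P
  total-transmission = begin
      W + Q
    ≡⟨ ΣL-+ (allFin r) _ _ ⟨
      ΣFin r (λ x → ΣFin (rs x) (λ i → transmission (x , i)) + rs x * θ (rs x))
    ≡⟨ ΣFin-cong r block-transmission ⟩
      ΣFin r (λ x → R * θ (rs x) + rs x * E x + rs x * Θ)
    ≡⟨ trans (ΣL-+ (allFin r) _ _) (cong (_+ ΣFin r (λ x → rs x * Θ)) (ΣL-+ (allFin r) _ _)) ⟩
      ΣFin r (λ x → R * θ (rs x)) + ΣFin r (λ x → rs x * E x) + ΣFin r (λ x → rs x * Θ)
    ≡⟨ cong₂ (λ u v → u + v + ΣFin r (λ x → rs x * Θ)) (ΣL-*ˡ (allFin r) R _) ΣrE ⟩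
      R * Θ + P + ΣFin r (λ x → rs x * Θ)
    ≡⟨ cong (R * Θ + P +_) (ΣL-*ʳ (allFin r) Θ rs) ⟩
      R * Θ + P + R * Θ
    ≡⟨ solve 2 (λ a p → a :+ p :+ a := con 2 :* a :+ p) refl (R * Θ) P ⟩
      2 * (R * Θ) + P ∎
    where open ≡-Reasoning

  hub-total : H ≡ θ r * R + r * Θ
  hub-total = begin
      ΣFin r (λ x → transmission (x , y x))
    ≡⟨ ΣFin-cong r hub-transmission ⟩
      ΣFin r (λ x → E x + Θ)
    ≡⟨ ΣL-+ (allFin r) E (λ _ → Θ) ⟩
      ΣFin r E + ΣFin r (λ _ → Θ)
    ≡⟨ cong₂ _+_ ΣE (ΣFin-const r Θ) ⟩
      θ r * R + r * Θ ∎
    where open ≡-Reasoning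

  -- The degree distance of G, with the negative term moved to the left.
  degreeDistance-formula : (dist : V → V → ℕ) → IsDistFn adjG dist →
    degreeDistance (GVerts r rs) adjG dist + 2 * Q ≡ 4 * R * Θ + (2 * (θ r * R) + 2 * (r * Θ)) + 2 * P
  degreeDistance-formula dist isDist = begin
      degreeDistance (GVerts r rs) adjG dist + 2 * Q
    ≡⟨ cong (_+ 2 * Q) (degreeDistance-split dist isDist) ⟩
      2 * W + 2 * H + 2 * Q
    ≡⟨ solve 3 (λ w h q → con 2 :* w :+ con 2 :* h :+ con 2 :* q := con 2 :* (w :+ q) :+ con 2 :* h) refl W H Q ⟩
      2 * (W + Q) + 2 * H
    ≡⟨ cong₂ (λ u v → 2 * u + 2 * v) total-transmission hub-total ⟩
      2 * (2 * (R * Θ) + P) + 2 * (θ r * R + r * Θ)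
    ≡⟨ solve 5 (λ a p t r θ → con 2 :* (con 2 :* a :+ p) :+ con 2 :* (t :+ r :* θ)
                            := con 4 :* a :+ (con 2 :* t :+ con 2 :* (r :* θ)) :+ con 2 :* p)
             refl (R * Θ) P (θ r * R) r Θ ⟩
      4 * (R * Θ) + (2 * (θ r * R) + 2 * (r * Θ)) + 2 * P
    ≡⟨ cong (λ z → z + (2 * (θ r * R) + 2 * (r * Θ)) + 2 * P) (*-assoc 4 R Θ) ⟨
      4 * R * Θ + (2 * (θ r * R) + 2 * (r * Θ)) + 2 * P ∎
    where open ≡-Reasoning

module Integers where

  import Data.Nat as ℕ
  open import Data.Integer using (+_; _+_; _-_) renaming (_*_ to _*ℤ_)
  open import Data.Integer.Properties using (pos-+; pos-*)
  open import Data.Integer.Solver using (module +-*-Solver)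
  open +-*-Solver using (solve; _:+_; _:*_; _:-_; _:=_; con)

  subtract-in-ℤ : ∀ M A a b c p → M ℕ.+ 2 * c ≡ A ℕ.+ (2 * a ℕ.+ 2 * b) ℕ.+ p →
                  + M ≡ + A + (+ 2) *ℤ ((+ a + + b) - + c) + + p
  subtract-in-ℤ M A a b c p h = begin
      + M
    ≡⟨ solve 2 (λ m c → m := (m :+ con (+ 2) :* c) :- con (+ 2) :* c) refl (+ M) (+ c) ⟩
      + M + (+ 2) *ℤ (+ c) - (+ 2) *ℤ (+ c)
    ≡⟨ cong (_- (+ 2) *ℤ (+ c)) cast ⟩
      + A + ((+ 2) *ℤ (+ a) + (+ 2) *ℤ (+ b)) + + p - (+ 2) *ℤ (+ c)
    ≡⟨ solve 5 (λ A a b p c → A :+ (con (+ 2) :* a :+ con (+ 2) :* b) :+ p :- con (+ 2) :* c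
                            := A :+ con (+ 2) :* ((a :+ b) :- c) :+ p) refl (+ A) (+ a) (+ b) (+ p) (+ c) ⟩
      + A + (+ 2) *ℤ ((+ a + + b) - + c) + + p ∎
    where
    open ≡-Reasoning
    cast : + M + (+ 2) *ℤ (+ c) ≡ + A + ((+ 2) *ℤ (+ a) + (+ 2) *ℤ (+ b)) + + p
    cast = begin
        + M + (+ 2) *ℤ (+ c)
      ≡⟨ trans (pos-+ M (2 * c)) (cong (_+_ (+ M)) (pos-* 2 c)) ⟨
        + (M ℕ.+ 2 * c)
      ≡⟨ cong +_ h ⟩
        + (A ℕ.+ (2 * a ℕ.+ 2 * b) ℕ.+ p)
      ≡⟨ trans (pos-+ _ p) (cong (_+ + p) (trans (pos-+ A _) (cong (_+_ (+ A)) (pos-+ (2 * a) (2 * b))))) ⟩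
        + A + (+ (2 * a) + + (2 * b)) + + p
      ≡⟨ cong₂ (λ u v → + A + (u + v) + + p) (pos-* 2 a) (pos-* 2 b) ⟩
        + A + ((+ 2) *ℤ (+ a) + (+ 2) *ℤ (+ b)) + + p ∎

open import Data.Integer using (ℤ; +_; _+_; _-_) renaming (_*_ to _*ℤ_)

proposition4p5 :
    (r : ℕ) → 3 ≤ r →
    (rs : Fin r → ℕ) → (∀ x → 3 ≤ rs x) →
    (y : (x : Fin r) → Fin (rs x)) →
    (D : Fin r → Fin r → ℕ) → IsDistFn (cycAdj r) D →
    (dist : GV r rs → GV r rs → ℕ) → IsDistFn (GAdj r rs y) dist →
    + degreeDistance (GVerts r rs) (GAdj r rs y) dist
      ≡ + (4 * ΣFin r rs * ΣFin r (λ x → θ (rs x)))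
        + (+ 2) *ℤ ((+ (θ r * ΣFin r rs) + + (r * ΣFin r (λ x → θ (rs x))))
                    - + ΣFin r (λ x → rs x * θ (rs x)))
        + + (2 * ΣFin r (λ x → ΣFin r (λ x' → rs x * D x x' * rs x')))
proposition4p5 r 3≤r rs 3≤rs y D D-dist dist isDist =
  subtract-in-ℤ (degreeDistance (GVerts r rs) (GAdj r rs y) dist) (4 * R * Θ) (θ r * R) (r * Θ) Q (2 * P)
                (degreeDistance-formula dist isDist)
  where
  open CycleOfCycles r 3≤r rs 3≤rs y D D-dist
  open Integers
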